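{- Let $\nu\in\mathcal{E}$ in expanded indexing, and let $i<i'$ be in $I$ with every $u\in\{i,i+2,\ldots,i'\}$ in $I$, such that for each $u\in[i,i')\cap I$, writing $\nu_u+\nu_{u+1}=k_p$ and $\nu_{u+2}+\nu_{u+3}=l_q$, one has $k-l=\Delta(p,q)$. If $\mathbf{Br}_\nu(i')>i'$, then $\mathbf{Br}_\nu(i)=\mathbf{Br}_\nu(i')$.
   Context: Primary colors $a_1<\cdots<a_n$; secondary colors $a_ia_j$ ($i<j$); total order $a_1a_2<\cdots<a_1a_n<a_1<a_2a_3<\cdots<a_2a_n<a_2<\cdots<a_{n-1}a_n<a_{n-1}<a_n$. A part $k_p$ has integer size $k$ and color $p$; $k_p+m=(k+m)_p$. $k_p\succ l_q$ iff $k-l\ge\chi(p\le q)$; $\succeq$ means $\succ$ or equal. Special pairs: $(a_ka_l,a_ia_j)$ with $i<j<k<l$ or $k<i<j<l$. $\mathcal{P}$: primary-colored parts of positive size; $\mathcal{S}$: secondary-colored parts of size $\ge2$. $k_p\gg l_q$ iff $k_p\succeq(l+1)_q$ when $p$ or $q$ primary; $k_p\succ(l+1)_q$ when both secondary and not special; $k_p\succ l_q$ when special. For secondary colors $p,q$, $\Delta(p,q)$ is the least integer $d$ with $k_p\gg(k-d)_q$ (the minimal size difference allowed by $\gg$). $\mathcal{E}$: finite sequences $\nu_1\gg\cdots\gg\nu_t$ in $\mathcal{P}\sqcup\mathcal{S}$. Halves: $\alpha((2k)_{a_ia_j})=k_{a_j}$, $\beta((2k)_{a_ia_j})=k_{a_i}$,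 $\alpha((2k+1)_{a_ia_j})=(k+1)_{a_i}$, $\beta((2k+1)_{a_ia_j})=k_{a_j}$. Expanded indexing: for $\nu$ with $p$ primary and $s$ secondary parts, $\nu=(\nu_1,\ldots,\nu_{p+2s})$ replacing each secondary part in place by upper half $\alpha$ then lower half $\beta$; $J$ = indices of primary parts, $I$ = indices of upper halves; $\nu_i+\nu_{i+1}$ ($i\in I$) is the original secondary part. Set $\nu_{p+2s+1}=0_{a_n}$. Bridge: for $i\in I$, $j=\min((i,p+2s+1]\cap(J\cup\{p+2s+1\}))$. If $\nu_{i'+1}\not\succ\nu_j+\frac{j-i'}{2}-1$ for all $i'\in[i,j)\cap I$, $\mathbf{Br}_\nu(i)=j$; otherwise with $\mathcal{S}_i=\{u\in(i,j)\cap I:\nu_{i'+1}\not\succ\nu_u+\frac{u-i'}{2}-1\ \forall i'\in[i,u)\cap I\}$, $\mathbf{Br}_\nu(i)=\max\mathcal{S}_i$ if nonempty, else $\mathbf{Br}_\nu(i)=i$. -}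

module Defs where

open import Data.Nat as ℕ using (ℕ; zero; suc)
open import Data.Integer as ℤ using (ℤ; +_; _-_; _+_)
open import Data.Integer.DivMod using (_/ℕ_; _%ℕ_)
open import Data.Fin as Fin using (Fin; toℕ; fromℕ)
open import Data.Bool using (if_then_else_)
open import Data.Product using (_×_; _,_; Σ-syntax)
open import Data.Sum using (_⊎_)
open import Data.Unit using (⊤)
open import Data.Empty using (⊥)
open import Data.Maybe using (Maybe; just; nothing; maybe)
open import Data.List using (List; []; _∷_; length)
open import Data.List.Relation.Unary.All using (All)
open import Data.List.Relation.Unary.Linked using (Linked)
open import Relation.Nullary using (¬_; does)
open import Relation.Binary.PropositionalEquality using (_≡_)

-- Colors.  With n primary colors a_1 < ... < a_n (here Fin n, 0-based),
-- secondary colors a_i a_j with i < j.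

data Color (n : ℕ) : Set where
  prim : Fin n → Color n
  sec  : (i j : Fin n) → i Fin.< j → Color n

-- Total order  a1a2 < ... < a1an < a1 < a2a3 < ... < a2an < a2 < ... < an :
-- lexicographic on (first index, second index), where a primary a_i has
-- second index "n" (larger than every j).
key : ∀ {n} → Color n → ℕ
key {n} (prim i)    = toℕ i ℕ.* suc n ℕ.+ n
key {n} (sec i j _) = toℕ i ℕ.* suc n ℕ.+ toℕ j

_≤c_ : ∀ {n} → Color n → Color n → Set
p ≤c q = key p ℕ.≤ key q

χ : ∀ {n} → Color n → Color n → ℤ
χ p q = if does (key p ℕ.≤? key q) then + 1 else + 0

IsPrimary : ∀ {n} → Color n → Set
IsPrimary (prim _)    = ⊤
IsPrimary (sec _ _ _) = ⊥

IsSecondary : ∀ {n} → Color n → Set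
IsSecondary (prim _)    = ⊥
IsSecondary (sec _ _ _) = ⊤

Special : ∀ {n} → Color n → Color n → Set
Special (sec k l _) (sec i j _) =
  (i Fin.< j × j Fin.< k × k Fin.< l) ⊎ (k Fin.< i × i Fin.< j × j Fin.< l)
Special _ _ = ⊥

Part : ℕ → Set
Part n = ℤ × Color n

_+ₚ_ : ∀ {n} → Part n → ℤ → Part n
(k , p) +ₚ m = (k + m , p)

_≻_ : ∀ {n} → Part n → Part n → Set
(k , p) ≻ (l , q) = χ p q ℤ.≤ k - l

_⪰_ : ∀ {n} → Part n → Part n → Set
x ⪰ y = x ≻ y ⊎ x ≡ y

_≫_ : ∀ {n} → Part n → Part n → Set
(k , sec a b h) ≫ (l , sec c d h') =
  (Special (sec a b h) (sec c d h') × (k , sec a b h) ≻ (l , sec c d h'))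
  ⊎ (¬ Special (sec a b h) (sec c d h') × (k , sec a b h) ≻ (l + + 1 , sec c d h'))
(k , p) ≫ (l , q) = (k , p) ⪰ (l + + 1 , q)

IsΔ : ∀ {n} → Color n → Color n → ℤ → Set
IsΔ p q d =
  (∀ k → (k , p) ≫ (k - d , q)) × (∀ d' k → (k , p) ≫ (k - d' , q) → d ℤ.≤ d')

InP : ∀ {n} → Part n → Set
InP (k , c) = IsPrimary c × + 1 ℤ.≤ k

InS : ∀ {n} → Part n → Set
InS (k , c) = IsSecondary c × + 2 ℤ.≤ k

InE : ∀ {n} → List (Part n) → Set
InE ν = All (λ x → InP x ⊎ InS x) ν × Linked _≫_ ν

-- Halves of a secondary part (only used on secondary parts).
-- α((2k)_{aiaj}) = k_{aj}, β((2k)_{aiaj}) = k_{ai},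
-- α((2k+1)_{aiaj}) = (k+1)_{ai}, β((2k+1)_{aiaj}) = k_{aj}.

α : ∀ {n} → Part n → Part n
α (s , sec i j _) with s %ℕ 2
... | zero  = (s /ℕ 2 , prim j)
... | suc _ = (s /ℕ 2 + + 1 , prim i)
α (s , prim a) = (s , prim a)

β : ∀ {n} → Part n → Part n
β (s , sec i j _) with s %ℕ 2
... | zero  = (s /ℕ 2 , prim i)
... | suc _ = (s /ℕ 2 , prim j)
β (s , prim a) = (s , prim a)

-- Expanded indexing.  Each entry remembers the original part; a primary
-- part gives one entry, a secondary part x gives an upper half α x
-- followed by a lower half β x.

data Entry (n : ℕ) : Set where
  primE upE lowE : Part n → Entry n

value : ∀ {n} → Entry n → Part n
value (primE x) = x
value (upE x)   = α x
value (lowE x)  = β x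

-- the original part (for an upper half u: ν_u + ν_{u+1})
orig : ∀ {n} → Entry n → Part n
orig (primE x) = x
orig (upE x)   = x
orig (lowE x)  = x

expand : ∀ {n} → List (Part n) → List (Entry n)
expand []                     = []
expand ((k , prim a) ∷ xs)    = primE (k , prim a) ∷ expand xs
expand ((k , sec i j h) ∷ xs) = upE (k , sec i j h) ∷ lowE (k , sec i j h) ∷ expand xs

-- 1-based lookup
at : ∀ {A : Set} → List A → ℕ → Maybe A
at xs       zero          = nothing
at []       (suc t)       = nothing
at (x ∷ xs) (suc zero)    = just x
at (x ∷ xs) (suc (suc t)) = at xs (suc t)

-- the terminal index p+2s+1
endIx : ∀ {n} → List (Entry n) → ℕ
endIx es = suc (length es)

-- ν_t in expanded indexing; positions outside 1..p+2s give the default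
-- part (used with default 0_{a_n}, i.e. ν_{p+2s+1} = 0_{a_n}).
val : ∀ {n} → Part n → List (Entry n) → ℕ → Part n
val d es t = maybe value d (at es t)

origAt : ∀ {n} → Part n → List (Entry n) → ℕ → Part n
origAt d es t = maybe orig d (at es t)

isUp : ∀ {n} → Maybe (Entry n) → Set
isUp (just (upE _)) = ⊤
isUp _              = ⊥

isPrimE : ∀ {n} → Maybe (Entry n) → Set
isPrimE (just (primE _)) = ⊤
isPrimE _                = ⊥

InI : ∀ {n} → List (Entry n) → ℕ → Set
InI es t = isUp (at es t)

InJ : ∀ {n} → List (Entry n) → ℕ → Set
InJ es t = isPrimE (at es t)

JorEnd : ∀ {n} → List (Entry n) → ℕ → Set
JorEnd es t = InJ es t ⊎ t ≡ endIx es

IsNext : ∀ {n} → List (Entry n) → ℕ → ℕ → Set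
IsNext es i j =
  i ℕ.< j × j ℕ.≤ endIx es × JorEnd es j
  × (∀ m → i ℕ.< m → m ℕ.< j → ¬ JorEnd es m)

NoBlock : ∀ {n} → Part n → List (Entry n) → ℕ → ℕ → Set
NoBlock d es i t =
  ∀ i' → i ℕ.≤ i' → i' ℕ.< t → InI es i' →
    ¬ (val d es (suc i') ≻ (val d es t +ₚ (+ ((t ℕ.∸ i') ℕ./ 2) - + 1)))

InSi : ∀ {n} → Part n → List (Entry n) → ℕ → ℕ → ℕ → Set
InSi d es i j u = i ℕ.< u × u ℕ.< j × InI es u × NoBlock d es i u

IsBr : ∀ {n} → Part n → List (Entry n) → ℕ → ℕ → Set
IsBr d es i b = Σ[ j ∈ ℕ ] (IsNext es i j ×
  ((NoBlock d es i j × b ≡ j)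
  ⊎ (¬ NoBlock d es i j ×
      ((InSi d es i j b × (∀ u → InSi d es i j u → u ℕ.≤ b))
      ⊎ ((∀ u → ¬ InSi d es i j u) × b ≡ i)))))

zeroLast : (m : ℕ) → Part (suc m)
zeroLast m = (+ 0 , prim (fromℕ m))

module Submission where

-- The heart of the argument is a statement about lower halves.  If P = k_p and
-- Q = l_q are secondary with k - l = Δ(p,q), then β(P) is at most one size step
-- above β(Q) (Δ-shape, β-descends); hence a block ν_{u+1} ≻ ν_t + (t-u)/2 - 1
-- witnessed by ν_{u+1} = β(P), where u is the upper half of P, is also a
-- block ν_{u+3} ≻ ν_t + (t-u-2)/2 - 1 witnessed by β(Q) (block-shifts).
-- Iterating along the run i, i+2, ..., i' shows that for every t > i' the
-- "no block" conditions seen from i and from i' coincide (NoBlock-chain).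
-- Since moreover no primary part lies between i and i', the bridges from i
-- and i' search up to the same primary index j (next-shift), and the case
-- analysis in the definition of Br then gives Br(i) = Br(i') as soon as
-- Br(i') > i' (bridge-agree).

open import Defs
open import Data.Fin as Fin using (Fin; toℕ)
import Data.Fin.Properties as FinP
open import Data.Empty using (⊥-elim)
open import Data.Sum using (_⊎_; inj₁; inj₂)
open import Data.Product using (Σ-syntax; _×_; _,_; proj₁; proj₂)
open import Data.Maybe using (just; maybe)
open import Data.List using (List; []; _∷_; length)
open import Relation.Nullary using (¬_; yes; no)
open import Relation.Nullary.Reflects using (ofʸ; ofⁿ)
open import Relation.Binary.Definitions using (tri<; tri≈; tri>)
open import Relation.Binary.PropositionalEquality
  using (_≡_; refl; sym; trans; cong; subst; subst₂; module ≡-Reasoning)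
import Data.Nat as ℕ
import Data.Nat.Properties as ℕP

module SizeArithmetic where

  open import Data.Nat using (ℕ; suc; z≤n; s≤s)
  open import Data.Integer using (ℤ; +_; _+_; _-_; _*_; _≤_; _<_; +<+; +≤+; -_)
  import Data.Integer.Properties as ℤP
  open import Data.Integer.DivMod using (_/ℕ_; _%ℕ_; a≡a%ℕn+[a/ℕn]*n; n%ℕd<d)
  open import Data.Integer.Tactic.RingSolver using (solve-∀)

  χ-spec : ∀ {n} (p q : Color n) → (p ≤c q × χ p q ≡ + 1) ⊎ (¬ p ≤c q × χ p q ≡ + 0)
  χ-spec p q with key p ℕ.≤ᵇ key q | ℕP.≤ᵇ-reflects-≤ (key p) (key q)
  ... | _ | ofʸ le  = inj₁ (le , refl)
  ... | _ | ofⁿ nle = inj₂ (nle , refl)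

  χ≤1 : ∀ {n} (p q : Color n) → χ p q ≤ + 1
  χ≤1 p q with χ-spec p q
  ... | inj₁ (_ , χ≡1) = ℤP.≤-reflexive χ≡1
  ... | inj₂ (_ , χ≡0) = subst (_≤ + 1) (sym χ≡0) (+≤+ z≤n)

  0≤χ : ∀ {n} (p q : Color n) → + 0 ≤ χ p q
  0≤χ p q with χ-spec p q
  ... | inj₁ (_ , χ≡1) = subst (+ 0 ≤_) (sym χ≡1) (+≤+ z≤n)
  ... | inj₂ (_ , χ≡0) = ℤP.≤-reflexive (sym χ≡0)

  χ-antitone : ∀ {n} (c₁ c₂ c : Color n) → c₁ ≤c c₂ → χ c₂ c ≤ χ c₁ c
  χ-antitone c₁ c₂ c c₁≤c₂ with χ-spec c₂ c | χ-spec c₁ c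
  ... | inj₁ (_ , e₂)     | inj₁ (_ , e₁)   = ℤP.≤-reflexive (trans e₂ (sym e₁))
  ... | inj₁ (c₂≤c , _)   | inj₂ (c₁≰c , _) = ⊥-elim (c₁≰c (ℕP.≤-trans c₁≤c₂ c₂≤c))
  ... | inj₂ (_ , χ₂≡0)   | _               = subst (_≤ χ c₁ c) (sym χ₂≡0) (0≤χ c₁ c)

  -- x ≼₁ y : x is at most one size above y, and if exactly one above then
  -- its color is not larger.  This is what makes a block by x one size
  -- higher transfer to a block by y.
  data _≼₁_ {n} : Part n → Part n → Set where
    not-above : ∀ {a b c₁ c₂} → a ≤ b → (a , c₁) ≼₁ (b , c₂)
    one-above : ∀ {b c₁ c₂} → c₁ ≤c c₂ → (b + + 1 , c₁) ≼₁ (b , c₂)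

  ≻-transfer : ∀ {n} {x y : Part n} (e : ℤ) (c : Color n) →
    x ≼₁ y → x ≻ (e + + 1 , c) → y ≻ (e , c)
  ≻-transfer {x = a , c₁} {b , c₂} e c (not-above a≤b) x≻ = begin
      χ c₂ c                ≤⟨ χ≤1 c₂ c ⟩
      + 1                   ≤⟨ ℤP.+-monoʳ-≤ (+ 1) (0≤χ c₁ c) ⟩
      + 1 + χ c₁ c          ≤⟨ ℤP.+-monoʳ-≤ (+ 1) x≻ ⟩
      + 1 + (a - (e + + 1)) ≡⟨ regroup a e ⟩
      a - e                 ≤⟨ ℤP.+-monoˡ-≤ (- e) a≤b ⟩
      b - e                 ∎
    where
    open ℤP.≤-Reasoning
    regroup : ∀ a e → + 1 + (a - (e + + 1)) ≡ a - e
    regroup = solve-∀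
  ≻-transfer {x = _ , c₁} {b , c₂} e c (one-above c₁≤c₂) x≻ = begin
      χ c₂ c                    ≤⟨ χ-antitone c₁ c₂ c c₁≤c₂ ⟩
      χ c₁ c                    ≤⟨ x≻ ⟩
      (b + + 1) - (e + + 1)     ≡⟨ cancel b e ⟩
      b - e                     ∎
    where
    open ℤP.≤-Reasoning
    cancel : ∀ b e → (b + + 1) - (e + + 1) ≡ b - e
    cancel = solve-∀

  quotient-≤ : ∀ r ρ a b → ρ ℕ.< 2 → + r + a * + 2 ≡ + ρ + b * + 2 → a ≤ b
  quotient-≤ r ρ a b ρ<2 eq with a ℤP.≤? b
  ... | yes a≤b = a≤b
  ... | no a≰b  = ⊥-elim (ℤP.<-irrefl (sym eq) below)
    where
    open ℤP.≤-Reasoning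
    double-suc : ∀ b → + 2 + b * + 2 ≡ (+ 1 + b) * + 2
    double-suc = solve-∀
    below : + ρ + b * + 2 < + r + a * + 2
    below = begin-strict
      + ρ + b * + 2    <⟨ ℤP.+-monoˡ-< (b * + 2) (+<+ ρ<2) ⟩
      + 2 + b * + 2    ≡⟨ double-suc b ⟩
      (+ 1 + b) * + 2  ≤⟨ ℤP.*-monoʳ-≤-nonNeg (+ 2) (ℤP.i<j⇒suc[i]≤j (ℤP.≰⇒> a≰b)) ⟩
      a * + 2          ≤⟨ ℤP.i≤j+i (a * + 2) (+ r) ⟩
      + r + a * + 2    ∎

  halving-unique : ∀ k ρ b → ρ ℕ.< 2 → k ≡ + ρ + b * + 2 → k %ℕ 2 ≡ ρ × k /ℕ 2 ≡ b
  halving-unique k ρ b ρ<2 k≡ = remainders , quotients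
    where
    open ≡-Reasoning
    r = k %ℕ 2
    a = k /ℕ 2
    same : + r + a * + 2 ≡ + ρ + b * + 2
    same = trans (sym (a≡a%ℕn+[a/ℕn]*n k 2)) k≡
    quotients : a ≡ b
    quotients = ℤP.≤-antisym (quotient-≤ r ρ a b ρ<2 same)
                             (quotient-≤ ρ r b a (n%ℕd<d k 2) (sym same))
    add-sub : ∀ x z → x ≡ x + z - z
    add-sub = solve-∀
    remainders : r ≡ ρ
    remainders = ℤP.+-injective (begin
      + r                   ≡⟨ add-sub (+ r) (b * + 2) ⟩
      + r + b * + 2 - b * + 2 ≡⟨ cong (λ q → + r + q * + 2 - b * + 2) (sym quotients) ⟩
      + r + a * + 2 - b * + 2 ≡⟨ cong (_- b * + 2) same ⟩
      + ρ + b * + 2 - b * + 2 ≡⟨ sym (add-sub (+ ρ) (b * + 2)) ⟩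
      + ρ                   ∎)

  parity : ∀ l → Σ[ b ∈ ℤ ] (l ≡ + 0 + b * + 2 ⊎ l ≡ + 1 + b * + 2)
  parity l with l %ℕ 2 | n%ℕd<d l 2 | a≡a%ℕn+[a/ℕn]*n l 2
  ... | 0           | _                | l≡ = l /ℕ 2 , inj₁ l≡
  ... | 1           | _                | l≡ = l /ℕ 2 , inj₂ l≡
  ... | suc (suc _) | s≤s (s≤s ())     | _

  β-even : ∀ {n} (x y : Fin n) (h : x Fin.< y) k b → k ≡ + 0 + b * + 2 →
    β (k , sec x y h) ≡ (b , prim x)
  β-even x y h k b k≡ with halving-unique k 0 b (s≤s z≤n) k≡
  ... | r≡0 , a≡b rewrite r≡0 | a≡b = refl

  β-odd : ∀ {n} (x y : Fin n) (h : x Fin.< y) k b → k ≡ + 1 + b * + 2 →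
    β (k , sec x y h) ≡ (b , prim y)
  β-odd x y h k b k≡ with halving-unique k 1 b (s≤s (s≤s z≤n)) k≡
  ... | r≡1 , a≡b rewrite r≡1 | a≡b = refl

  radix-≤ : ∀ {N} a b c d → b ℕ.< N → d ℕ.< N → a ℕ.* N ℕ.+ b ℕ.≤ c ℕ.* N ℕ.+ d →
    a ℕ.≤ c × (a ≡ c → b ℕ.≤ d)
  radix-≤ {N} a b c d b<N d<N le = a≤c , λ { refl → ℕP.+-cancelˡ-≤ (a ℕ.* N) b d le }
    where
    a≤c : a ℕ.≤ c
    a≤c with a ℕ.≤? c
    ... | yes a≤c = a≤c
    ... | no a≰c  = ⊥-elim (ℕP.<⇒≱ below le)
      where
      open ℕP.≤-Reasoning
      below : c ℕ.* N ℕ.+ d ℕ.< a ℕ.* N ℕ.+ b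
      below = begin-strict
        c ℕ.* N ℕ.+ d  <⟨ ℕP.+-monoʳ-< (c ℕ.* N) d<N ⟩
        c ℕ.* N ℕ.+ N  ≡⟨ ℕP.+-comm (c ℕ.* N) N ⟩
        suc c ℕ.* N    ≤⟨ ℕP.*-monoˡ-≤ N (ℕP.≰⇒> a≰c) ⟩
        a ℕ.* N        ≤⟨ ℕP.m≤m+n (a ℕ.* N) b ⟩
        a ℕ.* N ℕ.+ b  ∎

  prim-≤c : ∀ {n} {x z : Fin n} → x Fin.≤ z → prim x ≤c prim z
  prim-≤c {n} x≤z = ℕP.+-monoˡ-≤ n (ℕP.*-monoˡ-≤ (suc n) x≤z)

  via : ∀ {n} {P Q x y : Part n} → P ≡ x → Q ≡ y → x ≼₁ y → P ≼₁ Q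
  via refl refl x≼y = x≼y

  -- The admissible values δ of Δ(a_x a_y, a_z a_w) and what each value
  -- forces on the colors.
  data ΔShape {n} (x y z w : Fin n) : ℕ → Set where
    gap0 : ΔShape x y z w 0
    gap1 : x Fin.≤ w → ΔShape x y z w 1
    gap2 : x Fin.≤ z → y Fin.≤ w → ΔShape x y z w 2

  -- k_p ≫ (k-d)_q for secondary p, q, in terms of d alone.
  SecGap : ∀ {n} → Color n → Color n → ℤ → Set
  SecGap p q d = (Special p q × χ p q ≤ d) ⊎ (¬ Special p q × χ p q + + 1 ≤ d)

  module _ {n} {x y z w : Fin n} {h : x Fin.< y} {h' : z Fin.< w} where

    private
      p = sec x y h
      q = sec z w h'

    ≫⇒SecGap : ∀ k d → (k , p) ≫ (k - d , q) → SecGap p q d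
    ≫⇒SecGap k d (inj₁ (sp , le))  = inj₁ (sp , subst (χ p q ≤_) (k-[k-d] k d) le)
      where
      k-[k-d] : ∀ k d → k - (k - d) ≡ d
      k-[k-d] = solve-∀
    ≫⇒SecGap k d (inj₂ (nsp , le)) =
      inj₂ (nsp , subst (χ p q + + 1 ≤_) (k-[k-d+1] k d) (ℤP.+-monoˡ-≤ (+ 1) le))
      where
      k-[k-d+1] : ∀ k d → k - (k - d + + 1) + + 1 ≡ d
      k-[k-d+1] = solve-∀

    SecGap⇒≫ : ∀ k d → SecGap p q d → (k , p) ≫ (k - d , q)
    SecGap⇒≫ k d (inj₁ (sp , le))  = inj₁ (sp , subst (χ p q ≤_) (d≡ k d) le)
      where
      d≡ : ∀ k d → d ≡ k - (k - d)
      d≡ = solve-∀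
    SecGap⇒≫ k d (inj₂ (nsp , le)) =
      inj₂ (nsp , subst₂ _≤_ (cancel (χ p q)) (d-1≡ k d) (ℤP.+-monoˡ-≤ (- + 1) le))
      where
      cancel : ∀ c → c + + 1 - + 1 ≡ c
      cancel = solve-∀
      d-1≡ : ∀ k d → d - + 1 ≡ k - (k - d + + 1)
      d-1≡ = solve-∀

    Δ-gap : ∀ d → IsΔ p q d → (Special p q × d ≡ χ p q) ⊎ (¬ Special p q × d ≡ χ p q + + 1)
    Δ-gap d (attained , minimal) with ≫⇒SecGap (+ 0) d (attained (+ 0))
    ... | inj₁ (sp , χ≤d) =
      inj₁ (sp , ℤP.≤-antisym (minimal (χ p q) (+ 0) (SecGap⇒≫ (+ 0) _ (inj₁ (sp , ℤP.≤-refl)))) χ≤d)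
    ... | inj₂ (nsp , χ+1≤d) =
      inj₂ (nsp , ℤP.≤-antisym (minimal (χ p q + + 1) (+ 0) (SecGap⇒≫ (+ 0) _ (inj₂ (nsp , ℤP.≤-refl)))) χ+1≤d)

    key-lex : key p ℕ.≤ key q → x Fin.≤ z × (toℕ x ≡ toℕ z → y Fin.≤ w)
    key-lex = radix-≤ (toℕ x) (toℕ y) (toℕ z) (toℕ w)
                (ℕP.m<n⇒m<1+n (FinP.toℕ<n y)) (ℕP.m<n⇒m<1+n (FinP.toℕ<n w))

    Δ-shape : ∀ d → IsΔ p q d → Σ[ δ ∈ ℕ ] (d ≡ + δ × ΔShape x y z w δ)
    Δ-shape d isΔ with Δ-gap d isΔ | χ-spec p q
    ... | inj₁ (sp , d≡χ) | inj₂ (_ , χ≡0) = 0 , trans d≡χ χ≡0 , gap0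
    ... | inj₁ (sp , d≡χ) | inj₁ (p≤q , χ≡1) = 1 , trans d≡χ χ≡1 , gap1 (x≤w sp)
      where
      x≤w : Special p q → x Fin.≤ w
      x≤w (inj₁ (_ , w<x , _)) =
        ⊥-elim (ℕP.<⇒≱ (ℕP.<-trans h' w<x) (proj₁ (key-lex p≤q)))
      x≤w (inj₂ (x<z , z<w , _)) = ℕP.<⇒≤ (ℕP.<-trans x<z z<w)
    ... | inj₂ (nsp , d≡χ+1) | inj₂ (_ , χ≡0) =
      1 , trans d≡χ+1 (cong (_+ + 1) χ≡0) , gap1 (ℕP.≮⇒≥ λ w<x → nsp (inj₁ (h' , w<x , h)))
    ... | inj₂ (nsp , d≡χ+1) | inj₁ (p≤q , χ≡1) =
      2 , trans d≡χ+1 (cong (_+ + 1) χ≡1) , gap2 x≤z y≤w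
      where
      x≤z = proj₁ (key-lex p≤q)
      y≤w : y Fin.≤ w
      y≤w with toℕ x ℕ.≟ toℕ z
      ... | yes x≡z = proj₂ (key-lex p≤q) x≡z
      ... | no x≢z  = ℕP.≮⇒≥ λ w<y → nsp (inj₂ (ℕP.≤∧≢⇒< x≤z x≢z , h' , w<y))

    β-descends : ∀ {δ} → ΔShape x y z w δ → ∀ l → β (l + + δ , p) ≼₁ β (l , q)
    β-descends shape l with parity l
    β-descends gap0 _ | b , inj₁ refl =
      via (β-even x y h _ b (e0 b)) (β-even z w h' _ b refl) (not-above ℤP.≤-refl)
      where e0 : ∀ b → (+ 0 + b * + 2) + + 0 ≡ + 0 + b * + 2
            e0 = solve-∀
    β-descends (gap1 _) _ | b , inj₁ refl =
      via (β-odd x y h _ b (e1 b)) (β-even z w h' _ b refl) (not-above ℤP.≤-refl)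
      where e1 : ∀ b → (+ 0 + b * + 2) + + 1 ≡ + 1 + b * + 2
            e1 = solve-∀
    β-descends (gap2 x≤z _) _ | b , inj₁ refl =
      via (β-even x y h _ (b + + 1) (e2 b)) (β-even z w h' _ b refl) (one-above (prim-≤c x≤z))
      where e2 : ∀ b → (+ 0 + b * + 2) + + 2 ≡ + 0 + (b + + 1) * + 2
            e2 = solve-∀
    β-descends gap0 _ | b , inj₂ refl =
      via (β-odd x y h _ b (o0 b)) (β-odd z w h' _ b refl) (not-above ℤP.≤-refl)
      where o0 : ∀ b → (+ 1 + b * + 2) + + 0 ≡ + 1 + b * + 2
            o0 = solve-∀
    β-descends (gap1 x≤w) _ | b , inj₂ refl =
      via (β-even x y h _ (b + + 1) (o1 b)) (β-odd z w h' _ b refl) (one-above (prim-≤c x≤w))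
      where o1 : ∀ b → (+ 1 + b * + 2) + + 1 ≡ + 0 + (b + + 1) * + 2
            o1 = solve-∀
    β-descends (gap2 _ y≤w) _ | b , inj₂ refl =
      via (β-odd x y h _ (b + + 1) (o2 b)) (β-odd z w h' _ b refl) (one-above (prim-≤c y≤w))
      where o2 : ∀ b → (+ 1 + b * + 2) + + 2 ≡ + 1 + (b + + 1) * + 2
            o2 = solve-∀

    lower-half-descends : ∀ k l → IsΔ p q (k - l) → β (k , p) ≼₁ β (l , q)
    lower-half-descends k l isΔ with Δ-shape (k - l) isΔ
    ... | δ , k-l≡δ , shape = subst (λ k′ → β (k′ , p) ≼₁ β (l , q)) (sym k≡) (β-descends shape l)
      where
      split : ∀ k l → k ≡ l + (k - l)
      split = solve-∀
      k≡ : k ≡ l + + δ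
      k≡ = trans (split k l) (cong (λ d → l + d) k-l≡δ)

  -- Raising the threshold m of a block by one raises the compared part by one.
  threshold-suc : ∀ s m → s + ((+ 1 + m) - + 1) ≡ (s + (m - + 1)) + + 1
  threshold-suc = solve-∀

open SizeArithmetic

open import Data.Nat using (ℕ; zero; suc; _+_; _*_; _∸_; _/_; _≤_; _<_; z≤n; s≤s; s≤s⁻¹)
open import Data.Nat.Tactic.RingSolver using (solve-∀)
import Data.Nat.DivMod as ℕD
open import Data.Integer as ℤ using (+_; _-_)

data Secondary {n} : Part n → Set where
  secondary : ∀ k x y (h : x Fin.< y) → Secondary (k , sec x y h)

up-then-low : ∀ {n} (ν : List (Part n)) t x → at (expand ν) t ≡ just (upE x) →
  at (expand ν) (suc t) ≡ just (lowE x) × Secondary x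
up-then-low []                    (suc t)             x ()
up-then-low ((k , prim a) ∷ ν)    (suc zero)          x ()
up-then-low ((k , prim a) ∷ ν)    (suc (suc t))       x at≡ = up-then-low ν (suc t) x at≡
up-then-low ((k , sec a b h) ∷ ν) (suc zero)          _ refl = refl , secondary k a b h
up-then-low ((k , sec a b h) ∷ ν) (suc (suc zero))    x ()
up-then-low ((k , sec a b h) ∷ ν) (suc (suc (suc t))) x at≡ = up-then-low ν (suc t) x at≡

upper-half : ∀ {n} (es : List (Entry n)) t → InI es t → Σ[ x ∈ Part n ] at es t ≡ just (upE x)
upper-half es t t∈I with at es t
... | just (upE x) = x , refl

at-bound : ∀ {A : Set} (xs : List A) t {e} → at xs t ≡ just e → t ≤ length xs
at-bound []       (suc t)       ()
at-bound (x ∷ xs) (suc zero)    _   = s≤s z≤n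
at-bound (x ∷ xs) (suc (suc t)) at≡ = s≤s (at-bound xs (suc t) at≡)

half-not-JorEnd : ∀ {n} (es : List (Entry n)) t {e} → at es t ≡ just e →
  ¬ isPrimE (just e) → ¬ JorEnd es t
half-not-JorEnd es t at≡ notPrim (inj₁ t∈J) = notPrim (subst isPrimE at≡ t∈J)
half-not-JorEnd es t at≡ notPrim (inj₂ refl) = ℕP.<-irrefl refl (s≤s (at-bound es t at≡))

up-not-JorEnd : ∀ {n} (ν : List (Part n)) t → InI (expand ν) t → ¬ JorEnd (expand ν) t
up-not-JorEnd ν t t∈I = half-not-JorEnd (expand ν) t (proj₂ (upper-half _ t t∈I)) λ ()

low-not-JorEnd : ∀ {n} (ν : List (Part n)) t → InI (expand ν) t → ¬ JorEnd (expand ν) (suc t)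
low-not-JorEnd ν t t∈I with upper-half (expand ν) t t∈I
... | x , at≡ = half-not-JorEnd (expand ν) (suc t) (proj₁ (up-then-low ν t x at≡)) λ ()

low-not-I : ∀ {n} (es : List (Entry n)) t {x} → at es t ≡ just (lowE x) → ¬ InI es t
low-not-I es t at≡ t∈I = subst isUp at≡ t∈I

Blocks : ∀ {n} → Part n → List (Entry n) → ℕ → ℕ → Set
Blocks d es u t = val d es (suc u) ≻ (val d es t +ₚ (+ ((t ∸ u) / 2) - + 1))

-- Moving the upper half two places to the right lowers the threshold by one.
halved-gap : ∀ u t → u + 2 ≤ t → (t ∸ u) / 2 ≡ suc ((t ∸ (u + 2)) / 2)
halved-gap u t u+2≤t = begin
  (t ∸ u) / 2            ≡⟨ ℕD.m/n≡1+[m∸n]/n 2≤t∸u ⟩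
  suc ((t ∸ u ∸ 2) / 2)  ≡⟨ cong (λ m → suc (m / 2)) (ℕP.∸-+-assoc t u 2) ⟩
  suc ((t ∸ (u + 2)) / 2) ∎
  where
  open ≡-Reasoning
  2≤t∸u : 2 ≤ t ∸ u
  2≤t∸u = subst (_≤ t ∸ u) (ℕP.m+n∸m≡n u 2) (ℕP.∸-monoˡ-≤ u u+2≤t)

block-shifts : ∀ {n} (d : Part n) es u t {k l} {x y z w : Fin n} {h : x Fin.< y} {h' : z Fin.< w} →
  at es (suc u) ≡ just (lowE (k , sec x y h)) →
  at es (suc (u + 2)) ≡ just (lowE (l , sec z w h')) →
  IsΔ (sec x y h) (sec z w h') (k - l) → u + 2 ≤ t →
  Blocks d es u t → Blocks d es (u + 2) t
block-shifts d es u t {k} {l} {x} {y} {z} {w} {h} {h'} lowP lowQ isΔ u+2≤t blk =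
  subst (_≻ (s ℤ.+ (+ q - + 1) , c)) (sym (cong (maybe value d) lowQ))
    (≻-transfer (s ℤ.+ (+ q - + 1)) c (lower-half-descends {x = x} {y} {z} {w} {h} {h'} k l isΔ) blk′)
  where
  s = proj₁ (val d es t)
  c = proj₂ (val d es t)
  q = (t ∸ (u + 2)) / 2
  lowered : val d es t +ₚ (+ ((t ∸ u) / 2) - + 1) ≡ ((s ℤ.+ (+ q - + 1)) ℤ.+ + 1 , c)
  lowered = trans (cong (λ m → (s ℤ.+ (+ m - + 1) , c)) (halved-gap u t u+2≤t))
                  (cong (_, c) (threshold-suc s (+ q)))
  blk′ : β (k , sec x y h) ≻ ((s ℤ.+ (+ q - + 1)) ℤ.+ + 1 , c)
  blk′ = subst₂ _≻_ (cong (maybe value d) lowP) lowered blk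

ΔLinked : ∀ {n} → Part n → List (Part n) → ℕ → Set
ΔLinked d ν u = InI es u × InI es (u + 2) ×
  IsΔ (proj₂ (origAt d es u)) (proj₂ (origAt d es (u + 2)))
      (proj₁ (origAt d es u) - proj₁ (origAt d es (u + 2)))
  where es = expand ν

-- Across a Δ-linked pair, "no block from u+2" implies "no block from u":
-- the only new candidate, u itself, would block from u+2 as well.
NoBlock-step : ∀ {n} (d : Part n) ν u t → ΔLinked d ν u → u + 2 < t →
  NoBlock d (expand ν) (u + 2) t → NoBlock d (expand ν) u t
NoBlock-step d ν u t (u∈I , u+2∈I , isΔ) u+2<t nb
  with upper-half (expand ν) u u∈I | upper-half (expand ν) (u + 2) u+2∈I
... | P , atP | Q , atQ
  with up-then-low ν u P atP | up-then-low ν (u + 2) Q atQ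
... | lowP , secondary k x y h | lowQ , secondary l z w h' = no-block
  where
  isΔ′ : IsΔ (sec x y h) (sec z w h') (k - l)
  isΔ′ = subst₂ (λ A B → IsΔ (proj₂ A) (proj₂ B) (proj₁ A - proj₁ B))
           (cong (maybe orig d) atP) (cong (maybe orig d) atQ) isΔ
  no-block : NoBlock d (expand ν) u t
  no-block v u≤v v<t v∈I blk with ℕP.m≤n⇒m<n∨m≡n u≤v
  ... | inj₂ refl = nb (u + 2) ℕP.≤-refl u+2<t u+2∈I
                      (block-shifts d (expand ν) u t lowP lowQ isΔ′ (ℕP.<⇒≤ u+2<t) blk)
  ... | inj₁ u<v with ℕP.m≤n⇒m<n∨m≡n u<v
  ...   | inj₂ refl  = low-not-I (expand ν) (suc u) lowP v∈I
  ...   | inj₁ u+1<v = nb v (subst (_≤ v) (sym (ℕP.+-comm u 2)) u+1<v) v<t v∈I blk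

next-even : ∀ i s → i + 2 * suc s ≡ i + 2 * s + 2
next-even = solve-∀

two-more : ∀ i s → i + 2 * suc s ≡ suc (suc (i + 2 * s))
two-more = solve-∀

NoBlock-chain : ∀ {n} (d : Part n) ν i t r → (∀ s → s < r → ΔLinked d ν (i + 2 * s)) →
  i + 2 * r < t → NoBlock d (expand ν) (i + 2 * r) t → NoBlock d (expand ν) i t
NoBlock-chain d ν i t zero _ _ nb = subst (λ u → NoBlock d (expand ν) u t) (ℕP.+-identityʳ i) nb
NoBlock-chain d ν i t (suc r) links end<t nb =
  NoBlock-chain d ν i t r (λ s s<r → links s (ℕP.m<n⇒m<1+n s<r)) (ℕP.<-trans (ℕP.m<m+n _ (s≤s z≤n)) last<t)
    (NoBlock-step d ν (i + 2 * r) t (links r ℕP.≤-refl) last<t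
      (subst (λ u → NoBlock d (expand ν) u t) (next-even i r) nb))
  where
  last<t : i + 2 * r + 2 < t
  last<t = subst (_< t) (next-even i r) end<t

run-not-JorEnd : ∀ {n} (ν : List (Part n)) i r → (∀ s → s ≤ r → InI (expand ν) (i + 2 * s)) →
  ∀ v → i < v → v ≤ i + 2 * r → ¬ JorEnd (expand ν) v
run-not-JorEnd ν i zero _ v i<v v≤i = ⊥-elim (ℕP.<⇒≱ i<v (subst (v ≤_) (ℕP.+-identityʳ i) v≤i))
run-not-JorEnd ν i (suc r) uppers v i<v v≤end
  with ℕP.m≤n⇒m<n∨m≡n (subst (v ≤_) (two-more i r) v≤end)
... | inj₂ refl = up-not-JorEnd ν _ (subst (InI (expand ν)) (two-more i r) (uppers (suc r) ℕP.≤-refl))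
... | inj₁ v<end with ℕP.m≤n⇒m<n∨m≡n (s≤s⁻¹ v<end)
...   | inj₂ refl = low-not-JorEnd ν (i + 2 * r) (uppers r (ℕP.n≤1+n r))
...   | inj₁ v≤last = run-not-JorEnd ν i r (λ s s≤r → uppers s (ℕP.m≤n⇒m≤1+n s≤r)) v i<v (s≤s⁻¹ v≤last)

next-shift : ∀ {n} (es : List (Entry n)) {i i' j} → i ≤ i' →
  (∀ v → i < v → v ≤ i' → ¬ JorEnd es v) → IsNext es i j → IsNext es i' j
next-shift es i≤i' clear (i<j , j≤end , j∈J , before-j) =
  ℕP.≰⇒> (λ j≤i' → clear _ i<j j≤i' j∈J) , j≤end , j∈J ,
  λ v i'<v v<j → before-j v (ℕP.≤-<-trans i≤i' i'<v) v<j

next-unique : ∀ {n} (es : List (Entry n)) {i j j'} → IsNext es i j → IsNext es i j' → j ≡ j'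
next-unique es {j = j} {j'} (i<j , _ , j∈J , before-j) (i<j' , _ , j'∈J , before-j')
  with ℕP.<-cmp j j'
... | tri< j<j' _ _ = ⊥-elim (before-j' j i<j j<j' j∈J)
... | tri≈ _ j≡j' _ = j≡j'
... | tri> _ _ j'<j = ⊥-elim (before-j j' i<j' j'<j j'∈J)

BrCases : ∀ {n} → Part n → List (Entry n) → ℕ → ℕ → ℕ → Set
BrCases d es i j b =
  (NoBlock d es i j × b ≡ j)
  ⊎ (¬ NoBlock d es i j ×
      ((InSi d es i j b × (∀ u → InSi d es i j u → u ≤ b))
      ⊎ ((∀ u → ¬ InSi d es i j u) × b ≡ i)))

bridge-agree : ∀ {n} (d : Part n) es {i i' j b b'} → i ≤ i' → i' < b' →
  (∀ t → i' < t → NoBlock d es i' t → NoBlock d es i t) →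
  BrCases d es i j b → BrCases d es i' j b' → b ≡ b'
bridge-agree d es {i} {i'} {j} {b} {b'} i≤i' i'<b' widen = agree
  where
  narrow : ∀ t → NoBlock d es i t → NoBlock d es i' t
  narrow t nb v i'≤v = nb v (ℕP.≤-trans i≤i' i'≤v)
  lift : ∀ u → InSi d es i' j u → InSi d es i j u
  lift u (i'<u , u<j , u∈I , nb) = ℕP.≤-<-trans i≤i' i'<u , u<j , u∈I , widen u i'<u nb
  agree : BrCases d es i j b → BrCases d es i' j b' → b ≡ b'
  agree (inj₁ (_ , b≡j))      (inj₁ (_ , b'≡j))   = trans b≡j (sym b'≡j)
  agree (inj₂ (blocked , _))  (inj₁ (free , refl)) = ⊥-elim (blocked (widen b' i'<b' free))
  agree (inj₁ (free , _))     (inj₂ (blocked , _)) = ⊥-elim (blocked (narrow j free))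
  agree _ (inj₂ (_ , inj₂ (_ , refl)))           = ⊥-elim (ℕP.<-irrefl refl i'<b')
  agree (inj₂ (_ , inj₂ (none , _))) (inj₂ (_ , inj₁ (b'∈S , _))) = ⊥-elim (none b' (lift b' b'∈S))
  agree (inj₂ (_ , inj₁ ((i<b , b<j , b∈I , nb) , b-max))) (inj₂ (_ , inj₁ (b'∈S , b'-max))) =
    ℕP.≤-antisym b≤b' (b-max b' (lift b' b'∈S))
    where
    b≤b' : b ≤ b'
    b≤b' with b ℕP.≤? i'
    ... | yes b≤i' = ℕP.≤-trans b≤i' (ℕP.<⇒≤ i'<b')
    ... | no b≰i'  = b'-max b (ℕP.≰⇒> b≰i' , b<j , b∈I , narrow b nb)

lemma5p3 : (m : ℕ) (ν : List (Part (suc m))) → InE ν →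
    (i i' : ℕ) → i < i' → InI (expand ν) i → InI (expand ν) i' →
    (r : ℕ) → i' ≡ i + 2 * r → (∀ s → s ≤ r → InI (expand ν) (i + 2 * s)) →
    (∀ u → i ≤ u → u < i' → InI (expand ν) u →
      IsΔ (proj₂ (origAt (zeroLast m) (expand ν) u))
          (proj₂ (origAt (zeroLast m) (expand ν) (u + 2)))
          (proj₁ (origAt (zeroLast m) (expand ν) u) - proj₁ (origAt (zeroLast m) (expand ν) (u + 2)))) →
    (b b' : ℕ) → IsBr (zeroLast m) (expand ν) i b → IsBr (zeroLast m) (expand ν) i' b' →
    i' < b' → b ≡ b'
lemma5p3 m ν _ i .(i + 2 * r) i<i' _ _ r refl uppers hΔ b b' (j , next , br) (j' , next' , br') i'<b' =
  bridge-agree d es i≤i' i'<b' widen br (subst (λ k → BrCases d es (i + 2 * r) k b') (sym same-j) br')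
  where
  d = zeroLast m
  es = expand ν
  i≤i' = ℕP.<⇒≤ i<i'
  links : ∀ s → s < r → ΔLinked d ν (i + 2 * s)
  links s s<r =
    uppers s (ℕP.<⇒≤ s<r) ,
    subst (InI es) (next-even i s) (uppers (suc s) s<r) ,
    hΔ (i + 2 * s) (ℕP.m≤m+n i _) (ℕP.+-monoʳ-< i (ℕP.*-monoʳ-< 2 s<r)) (uppers s (ℕP.<⇒≤ s<r))
  widen : ∀ t → i + 2 * r < t → NoBlock d es (i + 2 * r) t → NoBlock d es i t
  widen t = NoBlock-chain d ν i t r links
  same-j : j ≡ j'
  same-j = next-unique es (next-shift es i≤i' (run-not-JorEnd ν i r uppers) next) next'
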